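{- Let $m,n\ge 1$, $H\subseteq\{0,\dots,m-1\}$ and $V\subseteq\{1,\dots,n\}$, and suppose $v\in V$ with $v\ge 2$ and $v-1\notin V$. Let $V'=(V\setminus\{v\})\cup\{v-1\}$. Then there is a bijection $\phi:\mathcal P_{m,n}\to\mathcal P_{m,n}$ such that for every path $p$, $\mathrm{CORNERS}^{(H,V')}(\phi(p))=\mathrm{CORNERS}^{(H,V)}(p)$ and $\mathrm{CINDEX}^{(H,V')}(\phi(p))=\mathrm{CINDEX}^{(H,V)}(p)-1$.
   Context: The grid $G_{m,n}$ has nodes $(i,j)$, $0\le i\le m$ (row, downward), $0\le j\le n$ (column, rightward). $\mathcal P_{m,n}$ is the set of lattice paths from $(0,0)$ to $(m,n)$ with unit down and right steps. A true corner is a node where a right step is immediately followed by a down step. For a pair $(H,V)$ with $H\subseteq\{0,\dots,m-1\}$, $V\subseteq\{1,\dots,n\}$, each $h\in H$ marks the node of the path on row $h$ from which it steps down to row $h+1$, and each $v\in V$ marks the node reached by the path's $v$-th right step. $\mathrm{CORNERS}^{(H,V)}(p)$ is the number of nodes that are true corners or marked (each node counted once), and $\mathrm{CINDEX}^{(H,V)}(p)$ is the sum of $i+j$ over these nodes $(i,j)$. -}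

module Defs where

open import Data.Nat using (ℕ; zero; suc; _+_)
open import Data.Bool using (Bool; true; false; _∧_; _∨_)
open import Data.List using (List; []; _∷_; length)
open import Data.Nat.ListAction using (sum)
open import Data.Maybe using (Maybe; just; nothing)
open import Data.Vec using ([]; _∷_)
open import Data.Fin.Subset using (Subset)

-- Lattice paths in G_{m,n} from (0,0) to (m,n), given by their first step:
-- 'down p'  : step down from (0,0), then follow (the translate of) p : Path m n
--             from (1,0) to (m+1,n);
-- 'right p' : step right, then follow p.
data Path : ℕ → ℕ → Set where
  stop  : Path 0 0
  down  : ∀ {m n} → Path m n → Path (suc m) n
  right : ∀ {m n} → Path m n → Path m (suc n)

data Step : Set where
  D R : Step

steps : ∀ {m n} → Path m n → List Step
steps stop      = []
steps (down p)  = D ∷ steps p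
steps (right p) = R ∷ steps p

memℕ : ∀ {k} → Subset k → ℕ → Bool
memℕ []       _       = false
memℕ (b ∷ bs) zero    = b
memℕ (b ∷ bs) (suc i) = memℕ bs i

isR : Maybe Step → Bool
isR (just R) = true
isR _        = false

isD : Maybe Step → Bool
isD (just D) = true
isD _        = false

head? : List Step → Maybe Step
head? []      = nothing
head? (s ∷ _) = just s

-- Marking data: H ⊆ {0,…,m-1} as a Subset m (element i ↔ row i);
-- V ⊆ {1,…,n} as a Subset (suc n) (element j ↔ column j) not containing 0.
-- A node (i,j) of the path, with incoming step 'prev' and outgoing step 'next', is
-- selected iff it is a true corner (prev = R, next = D), or it is marked by H
-- (next = D and i ∈ H: it is the node on row i from which the path steps down),
-- or it is marked by V (prev = R and j ∈ V: it is reached by the j-th right step,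
-- since after a right step the column equals the number of right steps so far).
selected : ∀ {m n'} → Subset m → Subset n' →
           Maybe Step → ℕ → ℕ → List Step → List ℕ
selected H V prev i j rest =
  let next = head? rest
      sel  = (isR prev ∧ isD next) ∨ (isD next ∧ memℕ H i) ∨ (isR prev ∧ memℕ V j)
      tl   = go rest
  in if sel then (i + j) ∷ tl else tl
  where
  if_then_else_ : Bool → List ℕ → List ℕ → List ℕ
  if true  then x else _ = x
  if false then _ else y = y
  go : List Step → List ℕ
  go []       = []
  go (D ∷ ss) = selected H V (just D) (suc i) j ss
  go (R ∷ ss) = selected H V (just R) i (suc j) ss

CORNERS : ∀ {m n} → Subset m → Subset (suc n) → Path m n → ℕ
CORNERS H V p = length (selected H V nothing 0 0 (steps p))

CINDEX : ∀ {m n} → Subset m → Subset (suc n) → Path m n → ℕ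
CINDEX H V p = sum (selected H V nothing 0 0 (steps p))

module Submission where

-- Put w = v - 1 and W = (V ─ ⁅ v ⁆) ∪ ⁅ w ⁆: the mark sets V and W agree on
-- every column except w (marked by W only) and w + 1 (marked by V only).  A
-- path reaches column w by its w-th right step at some row a, goes down k
-- steps, takes its (w+1)-st right step, goes down t - k more steps in column
-- w + 1 and then leaves that column or ends.  Selected nodes outside this
-- "block" do not see the marks of columns w and w + 1, so they are the same for
-- V and W.  Inside the block only the position k ∈ {0,…,t} of the right step is
-- free, and a permutation σ of {0,…,t}, built by recursion on t and guided by
-- the rows marked by H, makes the W-selected values of the block at σ k as many
-- as the V-selected values of the block at k, with sum one smaller (key lemma
-- 'blockW-σ⋖blockV').  The bijection φ replaces k by σ k in the block of
-- every path.

open import Defs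
open import Data.Bool using (Bool; true; false; not; _∧_; _∨_)
open import Data.Bool.Properties using (∨-identityʳ; ∨-zeroʳ; not-involutive)
open import Data.Empty using (⊥-elim)
open import Data.Fin using (Fin; zero; suc; toℕ; pred)
open import Data.Fin.Properties using (toℕ-inject₁; toℕ<n)
open import Data.Fin.Subset using (Subset; _∈_; _∉_; _∪_; _─_; ⁅_⁆; ⊥)
open import Data.List using (List; []; _∷_; length; _++_)
open import Data.List.Properties using (length-++)
open import Data.Maybe using (Maybe; just; nothing)
open import Data.Nat using (ℕ; zero; suc; _+_; _≤_; _<_; s≤s)
open import Data.Nat.ListAction using (sum)
open import Data.Nat.ListAction.Properties using (sum-++)
open import Data.Nat.Properties using (+-suc; +-assoc; +-comm; +-identityʳ; +-cancelʳ-≡; ≤-refl; ≤-trans; ≤-pred; n≤1+n; m≤m+n; 1+n≢n; <⇒≢; >⇒≢)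
open import Data.Product using (Σ; _×_; _,_; map₂)
open import Data.Vec using ([]; _∷_; here; there)
open import Function.Bundles using (_⤖_; Bijection; mk↔ₛ′)
open import Function.Properties.Inverse using (↔⇒⤖)
open import Relation.Binary.PropositionalEquality using (_≡_; _≢_; refl; sym; trans; cong; cong₂; subst; subst₂; module ≡-Reasoning)

-- L ⋖ L′: L′ has as many values as L and its sum is one larger.  The theorem
-- asserts exactly  selected-W (φ p) ⋖ selected-V p.
infix 4 _⋖_
record _⋖_ (L L′ : List ℕ) : Set where
  constructor raise
  field
    same-length  : length L ≡ length L′
    sum-plus-one : sum L + 1 ≡ sum L′

⋖-suc : ∀ x L → x ∷ L ⋖ suc x ∷ L
⋖-suc x L = raise refl (+-comm (x + sum L) 1)

⋖-cons : ∀ x {L L′} → L ⋖ L′ → x ∷ L ⋖ x ∷ L′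
⋖-cons x {L} (raise len sm) = raise (cong suc len) (trans (+-assoc x (sum L) 1) (cong (x +_) sm))

⋖-++ : ∀ {L L′} T → L ⋖ L′ → L ++ T ⋖ L′ ++ T
⋖-++ {L} {L′} T (raise len sm) = raise
  (trans (length-++ L) (trans (cong (_+ length T) len) (sym (length-++ L′))))
  (begin
    sum (L ++ T) + 1      ≡⟨ cong (_+ 1) (sum-++ L T) ⟩
    sum L + sum T + 1     ≡⟨ +-assoc (sum L) (sum T) 1 ⟩
    sum L + (sum T + 1)   ≡⟨ cong (sum L +_) (+-comm (sum T) 1) ⟩
    sum L + (1 + sum T)   ≡⟨ sym (+-assoc (sum L) 1 (sum T)) ⟩
    sum L + 1 + sum T     ≡⟨ cong (_+ sum T) sm ⟩
    sum L′ + sum T        ≡⟨ sym (sum-++ L′ T) ⟩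
    sum (L′ ++ T)         ∎)
  where open ≡-Reasoning

⋖-cancel : ∀ {A B C D} → A ⋖ B → B ⋖ C → D ⋖ C → A ⋖ D
⋖-cancel (raise lenAB smAB) (raise lenBC smBC) (raise lenDC smDC) = raise
  (trans lenAB (trans lenBC (sym lenDC)))
  (+-cancelʳ-≡ 1 _ _ (trans (cong (_+ 1) smAB) (trans smBC (sym smDC))))

consIf : Bool → ℕ → List ℕ → List ℕ
consIf true  x L = x ∷ L
consIf false x L = L

consIf-++ : ∀ b x L T → consIf b x L ++ T ≡ consIf b x (L ++ T)
consIf-++ true  x L T = refl
consIf-++ false x L T = refl

⋖-consIf : ∀ b x {L L′} → L ⋖ L′ → consIf b x L ⋖ consIf b x L′
⋖-consIf true  x r = ⋖-cons x r
⋖-consIf false x r = r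

-- 'sel' is 'selected' as a structural recursion on the steps, with the
-- selection test of a node made explicit.
module Selection {m k : ℕ} (H : Subset m) (X : Subset k) where

  isSelected : Maybe Step → Maybe Step → ℕ → ℕ → Bool
  isSelected prev next i j = (isR prev ∧ isD next) ∨ (isD next ∧ memℕ H i) ∨ (isR prev ∧ memℕ X j)

  sel : Maybe Step → ℕ → ℕ → List Step → List ℕ
  sel prev i j []       = consIf (isSelected prev nothing i j) (i + j) []
  sel prev i j (D ∷ ss) = consIf (isSelected prev (just D) i j) (i + j) (sel (just D) (suc i) j ss)
  sel prev i j (R ∷ ss) = consIf (isSelected prev (just R) i j) (i + j) (sel (just R) i (suc j) ss)

  selected≡sel : ∀ prev i j ss → selected H X prev i j ss ≡ sel prev i j ss
  selected≡sel prev i j [] with isSelected prev nothing i j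
  ... | true  = refl
  ... | false = refl
  selected≡sel prev i j (D ∷ ss) with isSelected prev (just D) i j
  ... | true  = cong ((i + j) ∷_) (selected≡sel (just D) (suc i) j ss)
  ... | false = selected≡sel (just D) (suc i) j ss
  selected≡sel prev i j (R ∷ ss) with isSelected prev (just R) i j
  ... | true  = cong ((i + j) ∷_) (selected≡sel (just R) i (suc j) ss)
  ... | false = selected≡sel (just R) i (suc j) ss

module _ {m k : ℕ} (H : Subset m) (X Y : Subset k) where
  private
    module SX = Selection H X
    module SY = Selection H Y

  isSelected-agree : ∀ prev next i j → memℕ X j ≡ memℕ Y j →
                     SX.isSelected prev next i j ≡ SY.isSelected prev next i j
  isSelected-agree prev next i j same =
    cong (λ b → (isR prev ∧ isD next) ∨ (isD next ∧ memℕ H i) ∨ (isR prev ∧ b)) same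

  sel-agree : ∀ prev i j ss → (∀ x → j ≤ x → memℕ X x ≡ memℕ Y x) →
              SX.sel prev i j ss ≡ SY.sel prev i j ss
  sel-agree prev i j [] same =
    cong (λ b → consIf b (i + j) []) (isSelected-agree prev nothing i j (same j ≤-refl))
  sel-agree prev i j (D ∷ ss) same =
    cong₂ (λ b L → consIf b (i + j) L) (isSelected-agree prev (just D) i j (same j ≤-refl))
      (sel-agree (just D) (suc i) j ss same)
  sel-agree prev i j (R ∷ ss) same =
    cong₂ (λ b L → consIf b (i + j) L) (isSelected-agree prev (just R) i j (same j ≤-refl))
      (sel-agree (just R) i (suc j) ss (λ x j<x → same x (≤-trans (n≤1+n j) j<x)))

-- How a path continues after a column: it ends, or it takes a right step.
data Exit : ℕ → ℕ → Set where
  end   : Exit 0 0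
  leave : ∀ {M N} → Path M N → Exit M (suc N)

exitPath : ∀ {M N} → Exit M N → Path M N
exitPath end       = stop
exitPath (leave p) = right p

downs : ∀ {M N} t → Path M N → Path (t + M) N
downs zero    p = p
downs (suc t) p = down (downs t p)

data Run : ℕ → ℕ → Set where
  run : ∀ {M N} t → Exit M N → Run (t + M) N

runPath : ∀ {M N} → Run M N → Path M N
runPath (run t e) = downs t (exitPath e)

downRun : ∀ {M N} → Run M N → Run (suc M) N
downRun (run t e) = run (suc t) e

toRun : ∀ {M N} → Path M N → Run M N
toRun stop      = run 0 end
toRun (down p)  = downRun (toRun p)
toRun (right p) = run 0 (leave p)

block : ∀ {M N} t → Fin (suc t) → Exit M N → Path (t + M) (suc N)
block t       zero    e = right (downs t (exitPath e))
block (suc t) (suc k) e = down (block t k e)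

data Block : ℕ → ℕ → Set where
  mkBlock : ∀ {M N} t → Fin (suc t) → Exit M N → Block (t + M) (suc N)

blockPath : ∀ {M N} → Block M N → Path M N
blockPath (mkBlock t k e) = block t k e

downBlock : ∀ {M N} → Block M N → Block (suc M) N
downBlock (mkBlock t k e) = mkBlock (suc t) (suc k) e

rightBlock : ∀ {M N} → Run M N → Block M (suc N)
rightBlock (run t e) = mkBlock t zero e

toBlock : ∀ {M N} → Path M (suc N) → Block M (suc N)
toBlock (down p)  = downBlock (toBlock p)
toBlock (right p) = rightBlock (toRun p)

runPath-downRun : ∀ {M N} (r : Run M N) → runPath (downRun r) ≡ down (runPath r)
runPath-downRun (run t e) = refl

runPath-toRun : ∀ {M N} (p : Path M N) → runPath (toRun p) ≡ p
runPath-toRun stop      = refl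
runPath-toRun (down p)  = trans (runPath-downRun (toRun p)) (cong down (runPath-toRun p))
runPath-toRun (right p) = refl

toRun-downs : ∀ {M N} t (e : Exit M N) → toRun (downs t (exitPath e)) ≡ run t e
toRun-downs zero    end       = refl
toRun-downs zero    (leave p) = refl
toRun-downs (suc t) e         = cong downRun (toRun-downs t e)

blockPath-downBlock : ∀ {M N} (b : Block M N) → blockPath (downBlock b) ≡ down (blockPath b)
blockPath-downBlock (mkBlock t k e) = refl

blockPath-rightBlock : ∀ {M N} (r : Run M N) → blockPath (rightBlock r) ≡ right (runPath r)
blockPath-rightBlock (run t e) = refl

blockPath-toBlock : ∀ {M N} (p : Path M (suc N)) → blockPath (toBlock p) ≡ p
blockPath-toBlock (down p)  = trans (blockPath-downBlock (toBlock p)) (cong down (blockPath-toBlock p))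
blockPath-toBlock (right p) = trans (blockPath-rightBlock (toRun p)) (cong right (runPath-toRun p))

toBlock-blockPath : ∀ {M N} (b : Block M (suc N)) → toBlock (blockPath b) ≡ b
toBlock-blockPath (mkBlock t zero e)          = cong rightBlock (toRun-downs t e)
toBlock-blockPath (mkBlock (suc t) (suc k) e) = cong downBlock (toBlock-blockPath (mkBlock t k e))

bump : ∀ {t} → Fin (suc t) → Fin (suc (suc t))
bump zero    = zero
bump (suc j) = suc (suc j)

-- A permutation f of {0,…,t}, acting on the shifted positions {1,…,t+1}, is
-- extended to {0,…,t+1}; the flag tells whether row 1 of the block is marked.
--   marked   : 0 ↦ 1,  j+1 ↦ bump (f j)
--   unmarked : 0 ↦ f 0 + 1,  1 ↦ 0,  j+2 ↦ f (j+1) + 1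
extend : Bool → ∀ {t} → (Fin (suc t) → Fin (suc t)) → Fin (suc (suc t)) → Fin (suc (suc t))
extend true          f zero          = suc zero
extend true          f (suc j)       = bump (f j)
extend false         f zero          = suc (f zero)
extend false         f (suc zero)    = zero
extend false {suc t} f (suc (suc j)) = suc (f (suc j))

extend-false-bump : ∀ {t} (f : Fin (suc t) → Fin (suc t)) y → extend false f (bump y) ≡ suc (f y)
extend-false-bump         f zero    = refl
extend-false-bump {suc t} f (suc y) = refl

extend-inverse : ∀ b {t} (f g : Fin (suc t) → Fin (suc t)) → (∀ y → f (g y) ≡ y) →
                 ∀ x → extend b f (extend (not b) g x) ≡ x
extend-inverse true          f g fg zero          = cong bump (fg zero)
extend-inverse true          f g fg (suc zero)    = refl
extend-inverse true  {suc t} f g fg (suc (suc j)) = cong bump (fg (suc j))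
extend-inverse false         f g fg zero          = refl
extend-inverse false         f g fg (suc j)       = trans (extend-false-bump f (g j)) (cong suc (fg j))

extend-inverse′ : ∀ b {t} (f g : Fin (suc t) → Fin (suc t)) → (∀ y → f (g y) ≡ y) →
                  ∀ x → extend (not b) f (extend b g x) ≡ x
extend-inverse′ b f g fg x =
  subst (λ c → extend (not b) f (extend c g x) ≡ x) (not-involutive b) (extend-inverse (not b) f g fg x)

-- h i tells whether row i is marked by H.  σ a t moves the right step of a
-- block of height t starting at row a; call a position k marked when
-- 0 < k < t and row a + k is marked.  Then σ sends 0 and every marked position
-- to the next marked position (or to t), and every other position k > 0 to
-- the previous unmarked one; ρ is its inverse.
module Reposition (h : ℕ → Bool) where

  σ ρ : ℕ → (t : ℕ) → Fin (suc t) → Fin (suc t)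
  σ a zero    = λ k → k
  σ a (suc t) = extend (h (suc a)) (σ (suc a) t)
  ρ a zero    = λ k → k
  ρ a (suc t) = extend (not (h (suc a))) (ρ (suc a) t)

  σ-ρ : ∀ a t k → σ a t (ρ a t k) ≡ k
  σ-ρ a zero    k = refl
  σ-ρ a (suc t) k = extend-inverse (h (suc a)) (σ (suc a) t) (ρ (suc a) t) (σ-ρ (suc a) t) k

  ρ-σ : ∀ a t k → ρ a t (σ a t k) ≡ k
  ρ-σ a zero    k = refl
  ρ-σ a (suc t) k = extend-inverse′ (h (suc a)) (ρ (suc a) t) (σ (suc a) t) (ρ-σ (suc a) t) k

-- The values selected in a block sitting in columns w and w+1, as explicit lists.
-- The value of node (i, w) is i + w, that of node (i, w+1) is suc (i + w).
module BlockValues (h : ℕ → Bool) (w : ℕ) where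
  open Reposition h

  -- Column w+1, rows i,…,i+r-1 entered and left by down steps: selected iff
  -- marked by H (the last node of the block, left by a right step or ending
  -- the path, is never selected).
  rightRun : ℕ → ℕ → List ℕ
  rightRun i zero    = []
  rightRun i (suc r) = consIf (h i) (suc (i + w)) (rightRun (suc i) r)

  -- Column w+1 from the node (i, w+1) reached by the right step, then t down
  -- steps: that node is a true corner if t ≥ 1, and selected iff β otherwise.
  rightColumn : Bool → ℕ → ℕ → List ℕ
  rightColumn β i zero    = consIf β (suc (i + w)) []
  rightColumn β i (suc t) = suc (i + w) ∷ rightRun (suc i) t

  leftColumn : Bool → ℕ → (t : ℕ) → Fin (suc t) → List ℕ
  leftColumn β i t       zero    = rightColumn β i t
  leftColumn β i (suc t) (suc k) = consIf (h i) (i + w) (leftColumn β (suc i) t k)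

  -- The whole block from the node (a, w) entered by a right step, where α and
  -- β say whether columns w and w+1 are marked.
  blockValues : Bool → Bool → ℕ → (t : ℕ) → Fin (suc t) → List ℕ
  blockValues α β a t       zero    = consIf α (a + w) (rightColumn β a t)
  blockValues α β a (suc t) (suc k) = (a + w) ∷ leftColumn β (suc a) t k

  blockV blockW : ℕ → (t : ℕ) → Fin (suc t) → List ℕ
  blockV = blockValues false true
  blockW = blockValues true false

  -- Row a+1 marked: its down node plays the role of the corner at row a.
  blockV-zero-marked : ∀ a t → h (suc a) ≡ true → blockV a (suc t) zero ≡ blockW (suc a) t zero
  blockV-zero-marked a zero    marked = refl
  blockV-zero-marked a (suc t) marked rewrite marked = refl

  blockV-suc-marked : ∀ a t k → h (suc a) ≡ true → blockV a (suc t) (suc k) ≡ (a + w) ∷ blockV (suc a) t k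
  blockV-suc-marked a t       zero    marked = refl
  blockV-suc-marked a (suc t) (suc k) marked rewrite marked = refl

  blockW-bump-marked : ∀ a t k → h (suc a) ≡ true → blockW a (suc t) (bump k) ≡ (a + w) ∷ blockW (suc a) t k
  blockW-bump-marked a t       zero    marked = cong ((a + w) ∷_) (blockV-zero-marked a t marked)
  blockW-bump-marked a (suc t) (suc k) marked rewrite marked = refl

  blockW-one : ∀ a t → blockW a (suc t) (suc zero) ⋖ blockW (suc a) t zero
  blockW-one a t = ⋖-suc (a + w) (rightColumn false (suc a) t)

  blockV-zero-unmarked : ∀ a t → h (suc a) ≡ false → blockV a (suc t) zero ⋖ blockV (suc a) t zero
  blockV-zero-unmarked a zero    unmarked = ⋖-suc (suc (a + w)) []
  blockV-zero-unmarked a (suc t) unmarked rewrite unmarked = ⋖-suc (suc (a + w)) (rightRun (suc (suc a)) t)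

  block-suc-unmarked : ∀ α β a t k → h (suc a) ≡ false →
                       blockValues α β a (suc (suc t)) (suc (suc k)) ⋖ blockValues α β (suc a) (suc t) (suc k)
  block-suc-unmarked α β a t k unmarked rewrite unmarked = ⋖-suc (a + w) (leftColumn β (suc (suc a)) t k)

  blockW-suc-unmarked : ∀ a t k → h (suc a) ≡ false → blockW a (suc t) (suc k) ⋖ blockW (suc a) t k
  blockW-suc-unmarked a t       zero    unmarked = blockW-one a t
  blockW-suc-unmarked a (suc t) (suc k) unmarked = block-suc-unmarked true false a t k unmarked

  -- Key lemma: the W-block at σ k has as many values as the V-block at k,
  -- with sum one smaller.  The induction step is stated for 'extend b' with b
  -- the mark of row a+1.
  blockW-σ⋖blockV : ∀ a t k → blockW a t (σ a t k) ⋖ blockV a t k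
  blockW-extend⋖blockV : ∀ a t b → h (suc a) ≡ b →
                         ∀ k → blockW a (suc t) (extend b (σ (suc a) t) k) ⋖ blockV a (suc t) k

  blockW-σ⋖blockV a zero    zero = ⋖-suc (a + w) []
  blockW-σ⋖blockV a (suc t) k    = blockW-extend⋖blockV a t (h (suc a)) refl k

  blockW-extend⋖blockV a t true marked zero =
    subst (blockW a (suc t) (suc zero) ⋖_) (sym (blockV-zero-marked a t marked)) (blockW-one a t)
  blockW-extend⋖blockV a t true marked (suc k) =
    subst₂ _⋖_ (sym (blockW-bump-marked a t (σ (suc a) t k) marked)) (sym (blockV-suc-marked a t k marked))
      (⋖-cons (a + w) (blockW-σ⋖blockV (suc a) t k))
  blockW-extend⋖blockV a t false unmarked zero =
    ⋖-cancel (blockW-suc-unmarked a t (σ (suc a) t zero) unmarked) (blockW-σ⋖blockV (suc a) t zero)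
      (blockV-zero-unmarked a t unmarked)
  blockW-extend⋖blockV a t false unmarked (suc zero) = ⋖-cons (a + w) (blockV-zero-unmarked a t unmarked)
  blockW-extend⋖blockV a (suc t) false unmarked (suc (suc k)) =
    ⋖-cancel (blockW-suc-unmarked a (suc t) (σ (suc a) (suc t) (suc k)) unmarked)
      (blockW-σ⋖blockV (suc a) (suc t) (suc k)) (block-suc-unmarked false true a t k unmarked)

module BlockSelection {m k : ℕ} (H : Subset m) (X : Subset k) (w : ℕ) where
  open Selection H X
  open BlockValues (memℕ H) w

  exitValues : ∀ {M N} → ℕ → Exit M N → List ℕ
  exitValues c end       = []
  exitValues c (leave p) = sel (just R) c (suc (suc w)) (steps p)

  rightRun-sel : ∀ {M N} i t (e : Exit M N) →
                 sel (just D) i (suc w) (steps (downs t (exitPath e))) ≡ rightRun i t ++ exitValues (i + t) e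
  rightRun-sel i zero    end       = refl
  rightRun-sel i zero    (leave p) rewrite +-identityʳ i = refl
  rightRun-sel i (suc t) e rewrite ∨-identityʳ (memℕ H i) | rightRun-sel (suc i) t e | +-suc i t | +-suc i w =
    sym (consIf-++ (memℕ H i) (suc (i + w)) (rightRun (suc i) t) (exitValues (suc (i + t)) e))

  rightColumn-sel : ∀ {M N} i t (e : Exit M N) →
                    sel (just R) i (suc w) (steps (downs t (exitPath e)))
                      ≡ rightColumn (memℕ X (suc w)) i t ++ exitValues (i + t) e
  rightColumn-sel i zero    end       rewrite +-suc i w = sym (consIf-++ (memℕ X (suc w)) (suc (i + w)) [] [])
  rightColumn-sel i zero    (leave p) rewrite +-suc i w | +-identityʳ i =
    sym (consIf-++ (memℕ X (suc w)) (suc (i + w)) [] (sel (just R) i (suc (suc w)) (steps p)))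
  rightColumn-sel i (suc t) e rewrite rightRun-sel (suc i) t e | +-suc i t | +-suc i w = refl

  leftColumn-sel : ∀ {M N} i t k (e : Exit M N) →
                   sel (just D) i w (steps (block t k e))
                     ≡ leftColumn (memℕ X (suc w)) i t k ++ exitValues (i + t) e
  leftColumn-sel i t       zero    e = rightColumn-sel i t e
  leftColumn-sel i (suc t) (suc k) e rewrite ∨-identityʳ (memℕ H i) | leftColumn-sel (suc i) t k e | +-suc i t =
    sym (consIf-++ (memℕ H i) (i + w) (leftColumn (memℕ X (suc w)) (suc i) t k) (exitValues (suc (i + t)) e))

  block-sel : ∀ {M N} a t k (e : Exit M N) →
              sel (just R) a w (steps (block t k e))
                ≡ blockValues (memℕ X w) (memℕ X (suc w)) a t k ++ exitValues (a + t) e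
  block-sel a t zero e rewrite rightColumn-sel a t e =
    sym (consIf-++ (memℕ X w) (a + w) (rightColumn (memℕ X (suc w)) a t) (exitValues (a + t) e))
  block-sel a (suc t) (suc k) e rewrite leftColumn-sel (suc a) t k e | +-suc a t = refl

Positions : Set
Positions = ℕ → (t : ℕ) → Fin (suc t) → Fin (suc t)

moveStep : Positions → ℕ → ∀ {M N} → Block M N → Block M N
moveStep π a (mkBlock t k e) = mkBlock t (π a t k) e

reblock : Positions → ℕ → ∀ {M N} → Path M N → Path M N
reblock π a {N = zero}  p = p
reblock π a {N = suc N} p = blockPath (moveStep π a (toBlock p))

reblock-inverse : ∀ (π π′ : Positions) → (∀ a t k → π a t (π′ a t k) ≡ k) →
                  ∀ a {M N} (p : Path M N) → reblock π a (reblock π′ a p) ≡ p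
reblock-inverse π π′ ππ′ a {N = zero}  p = refl
reblock-inverse π π′ ππ′ a {N = suc N} p
  rewrite toBlock-blockPath (moveStep π′ a (toBlock p)) =
  trans (cong blockPath (moveStep-inverse (toBlock p))) (blockPath-toBlock p)
  where
  moveStep-inverse : ∀ {M N} (b : Block M N) → moveStep π a (moveStep π′ a b) ≡ b
  moveStep-inverse (mkBlock t k e) = cong (λ k′ → mkBlock t k′ e) (ππ′ a t k)

after : ℕ → (ℕ → ∀ {M N} → Path M N → Path M N) → ℕ → ∀ {M N} → Path M N → Path M N
after zero    g i p         = g i p
after (suc c) g i stop      = stop
after (suc c) g i (down p)  = down (after (suc c) g (suc i) p)
after (suc c) g i (right p) = right (after c g i p)

after-inverse : ∀ (g g′ : ℕ → ∀ {M N} → Path M N → Path M N) →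
                (∀ i {M N} (p : Path M N) → g i (g′ i p) ≡ p) →
                ∀ c i {M N} (p : Path M N) → after c g i (after c g′ i p) ≡ p
after-inverse g g′ gg′ zero    i p         = gg′ i p
after-inverse g g′ gg′ (suc c) i stop      = refl
after-inverse g g′ gg′ (suc c) i (down p)  = cong down (after-inverse g g′ gg′ (suc c) (suc i) p)
after-inverse g g′ gg′ (suc c) i (right p) = cong right (after-inverse g g′ gg′ c i p)

record MarkShift {k : ℕ} (V W : Subset k) (w : ℕ) : Set where
  field
    V-unmarked-w     : memℕ V w ≡ false
    V-marked-suc-w   : memℕ V (suc w) ≡ true
    W-marked-w       : memℕ W w ≡ true
    W-unmarked-suc-w : memℕ W (suc w) ≡ false
    agree            : ∀ x → x ≢ w → x ≢ suc w → memℕ W x ≡ memℕ V x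

module Shifted {m k : ℕ} (H : Subset m) {V W : Subset k} {w : ℕ} (shift : MarkShift V W w) where
  open MarkShift shift
  open Reposition (memℕ H)
  open BlockValues (memℕ H) w
  private
    module SV = Selection H V
    module SW = Selection H W
    module BV = BlockSelection H V w
    module BW = BlockSelection H W w

  agree-before : ∀ j c → j + suc c ≡ w → memℕ W j ≡ memℕ V j
  agree-before j c j+c≡w = agree j (<⇒≢ j<w) (<⇒≢ (≤-trans j<w (n≤1+n w)))
    where
    j<w : j < w
    j<w = subst (suc j ≤_) (trans (sym (+-suc j c)) j+c≡w) (s≤s (m≤m+n j c))

  exitValues-agree : ∀ {M N} c (e : Exit M N) → BW.exitValues c e ≡ BV.exitValues c e
  exitValues-agree c end       = refl
  exitValues-agree c (leave p) = sel-agree H W V (just R) c (suc (suc w)) (steps p)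
    (λ x w+2≤x → agree x (>⇒≢ (≤-trans (n≤1+n (suc w)) w+2≤x)) (>⇒≢ w+2≤x))

  block-⋖ : ∀ a {M N} (b : Block M (suc N)) →
            SW.sel (just R) a w (steps (blockPath (moveStep σ a b))) ⋖ SV.sel (just R) a w (steps (blockPath b))
  block-⋖ a (mkBlock t k e)
    rewrite BW.block-sel a t (σ a t k) e | BV.block-sel a t k e | exitValues-agree (a + t) e
          | W-marked-w | W-unmarked-suc-w | V-unmarked-w | V-marked-suc-w =
    ⋖-++ (BV.exitValues (a + t) e) (blockW-σ⋖blockV a t k)

  reblock-⋖ : ∀ a {M N} (p : Path M (suc N)) →
              SW.sel (just R) a w (steps (reblock σ a p)) ⋖ SV.sel (just R) a w (steps p)
  reblock-⋖ a p =
    subst (λ q → SW.sel (just R) a w (steps (reblock σ a p)) ⋖ SV.sel (just R) a w (steps q))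
      (blockPath-toBlock p) (block-⋖ a (toBlock p))

  -- Before the block the marks of V and W agree, so the same nodes are selected.
  after-⋖ : ∀ c i j prev {M N} (p : Path M N) → j + suc c ≡ w → suc (suc c) ≤ N →
            SW.sel prev i j (steps (after (suc c) (reblock σ) i p)) ⋖ SV.sel prev i j (steps p)
  after-⋖ c i j prev (down p) j+c≡w c+2≤N
    rewrite isSelected-agree H W V prev (just D) i j (agree-before j c j+c≡w) =
    ⋖-consIf (SV.isSelected prev (just D) i j) (i + j) (after-⋖ c (suc i) j (just D) p j+c≡w c+2≤N)
  after-⋖ zero i j prev {N = suc (suc N)} (right p) j+1≡w _
    rewrite isSelected-agree H W V prev (just R) i j (agree-before j zero j+1≡w) =
    ⋖-consIf (SV.isSelected prev (just R) i j) (i + j)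
      (subst (λ j′ → SW.sel (just R) i j′ (steps (reblock σ i p)) ⋖ SV.sel (just R) i j′ (steps p))
        (trans (sym j+1≡w) (+-comm j 1)) (reblock-⋖ i p))
  after-⋖ zero i j prev {N = suc zero} (right p) _ (s≤s ())
  after-⋖ (suc c) i j prev (right p) j+c≡w (s≤s c+2≤N)
    rewrite isSelected-agree H W V prev (just R) i j (agree-before j (suc c) j+c≡w) =
    ⋖-consIf (SV.isSelected prev (just R) i j) (i + j)
      (after-⋖ c i (suc j) (just R) p (trans (sym (+-suc j (suc c))) j+c≡w) c+2≤N)

  shift-bijection : ∀ c → suc c ≡ w → ∀ {M N} → suc (suc c) ≤ N →
    Σ (Path M N ⤖ Path M N) λ φ → (p : Path M N) →
      selected H W nothing 0 0 (steps (Bijection.to φ p)) ⋖ selected H V nothing 0 0 (steps p)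
  shift-bijection c c+1≡w c+2≤N = φ , selected-⋖
    where
    φ : Path _ _ ⤖ Path _ _
    φ = ↔⇒⤖ (mk↔ₛ′ (after (suc c) (reblock σ) 0) (after (suc c) (reblock ρ) 0)
                   (after-inverse _ _ (reblock-inverse σ ρ σ-ρ) (suc c) 0)
                   (after-inverse _ _ (reblock-inverse ρ σ ρ-σ) (suc c) 0))
    selected-⋖ : ∀ p → selected H W nothing 0 0 (steps (Bijection.to φ p)) ⋖ selected H V nothing 0 0 (steps p)
    selected-⋖ p = subst₂ _⋖_ (sym (SW.selected≡sel nothing 0 0 (steps (Bijection.to φ p))))
                                (sym (SV.selected≡sel nothing 0 0 (steps p)))
                     (after-⋖ c 0 0 nothing p c+1≡w c+2≤N)

memℕ-∪ : ∀ {k} (p q : Subset k) x → memℕ (p ∪ q) x ≡ memℕ p x ∨ memℕ q x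
memℕ-∪ []      []      x       = refl
memℕ-∪ (a ∷ p) (b ∷ q) zero    = refl
memℕ-∪ (a ∷ p) (b ∷ q) (suc x) = memℕ-∪ p q x

memℕ-─-in : ∀ {k} (p q : Subset k) x → memℕ q x ≡ true → memℕ (p ─ q) x ≡ false
memℕ-─-in []      []          x       _   = refl
memℕ-─-in (a ∷ p) (true ∷ q)  zero    _   = refl
memℕ-─-in (a ∷ p) (b ∷ q)     (suc x) x∈q = memℕ-─-in p q x x∈q

memℕ-─-out : ∀ {k} (p q : Subset k) x → memℕ q x ≡ false → memℕ (p ─ q) x ≡ memℕ p x
memℕ-─-out []      []          x       _   = refl
memℕ-─-out (a ∷ p) (false ∷ q) zero    _   = refl
memℕ-─-out (a ∷ p) (b ∷ q)     (suc x) x∉q = memℕ-─-out p q x x∉q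

memℕ-⊥ : ∀ {k} x → memℕ (⊥ {k}) x ≡ false
memℕ-⊥ {zero}  x       = refl
memℕ-⊥ {suc k} zero    = refl
memℕ-⊥ {suc k} (suc x) = memℕ-⊥ {k} x

memℕ-⁅⁆ : ∀ {k} (i : Fin k) → memℕ ⁅ i ⁆ (toℕ i) ≡ true
memℕ-⁅⁆ zero    = refl
memℕ-⁅⁆ (suc i) = memℕ-⁅⁆ i

memℕ-⁅⁆-≢ : ∀ {k} (i : Fin k) x → x ≢ toℕ i → memℕ ⁅ i ⁆ x ≡ false
memℕ-⁅⁆-≢         zero    zero    x≢i = ⊥-elim (x≢i refl)
memℕ-⁅⁆-≢ {suc k} zero    (suc x) _   = memℕ-⊥ {k} x
memℕ-⁅⁆-≢         (suc i) zero    _   = refl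
memℕ-⁅⁆-≢         (suc i) (suc x) x≢i = memℕ-⁅⁆-≢ i x (λ x≡i → x≢i (cong suc x≡i))

∈⇒memℕ : ∀ {k} {S : Subset k} {i} → i ∈ S → memℕ S (toℕ i) ≡ true
∈⇒memℕ here        = refl
∈⇒memℕ (there i∈S) = ∈⇒memℕ i∈S

∉⇒memℕ : ∀ {k} (S : Subset k) i → i ∉ S → memℕ S (toℕ i) ≡ false
∉⇒memℕ (true  ∷ S) zero    i∉S = ⊥-elim (i∉S here)
∉⇒memℕ (false ∷ S) zero    _   = refl
∉⇒memℕ (b ∷ S)     (suc i) i∉S = ∉⇒memℕ S i (λ i∈S → i∉S (there i∈S))

moveMark : ∀ {k} (V : Subset k) (u v : Fin k) {w} → toℕ u ≡ w → toℕ v ≡ suc w → v ∈ V → u ∉ V →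
           MarkShift V ((V ─ ⁅ v ⁆) ∪ ⁅ u ⁆) w
moveMark V u v refl v≡u+1 v∈V u∉V = record
  { V-unmarked-w     = ∉⇒memℕ V u u∉V
  ; V-marked-suc-w   = subst (λ x → memℕ V x ≡ true) v≡u+1 (∈⇒memℕ v∈V)
  ; W-marked-w       = trans (memℕ-∪ (V ─ ⁅ v ⁆) ⁅ u ⁆ (toℕ u))
      (trans (cong (memℕ (V ─ ⁅ v ⁆) (toℕ u) ∨_) (memℕ-⁅⁆ u)) (∨-zeroʳ (memℕ (V ─ ⁅ v ⁆) (toℕ u))))
  ; W-unmarked-suc-w = trans (memℕ-∪ (V ─ ⁅ v ⁆) ⁅ u ⁆ (suc (toℕ u)))
      (cong₂ _∨_ (memℕ-─-in V ⁅ v ⁆ (suc (toℕ u)) (subst (λ x → memℕ ⁅ v ⁆ x ≡ true) v≡u+1 (memℕ-⁅⁆ v)))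
                 (memℕ-⁅⁆-≢ u (suc (toℕ u)) 1+n≢n))
  ; agree            = λ x x≢u x≢u+1 → trans (memℕ-∪ (V ─ ⁅ v ⁆) ⁅ u ⁆ x)
      (trans (cong₂ _∨_ (memℕ-─-out V ⁅ v ⁆ x (memℕ-⁅⁆-≢ v x (λ x≡v → x≢u+1 (trans x≡v v≡u+1))))
                        (memℕ-⁅⁆-≢ u x x≢u))
             (∨-identityʳ (memℕ V x)))
  }

mainTheorem5 : (m n : ℕ) → 1 ≤ m → 1 ≤ n →
    (H : Subset m) (V : Subset (suc n)) → zero ∉ V →
    (v : Fin (suc n)) → v ∈ V → 2 ≤ toℕ v → pred v ∉ V →
    Σ (Path m n ⤖ Path m n) λ φ → (p : Path m n) →
      (CORNERS H ((V ─ ⁅ v ⁆) ∪ ⁅ pred v ⁆) (Bijection.to φ p) ≡ CORNERS H V p)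
      × (CINDEX H ((V ─ ⁅ v ⁆) ∪ ⁅ pred v ⁆) (Bijection.to φ p) + 1 ≡ CINDEX H V p)
mainTheorem5 m n _ _ H V _ (suc (suc v₀)) v∈V (s≤s (s≤s _)) v-1∉V =
  map₂ (λ φ-⋖ p → _⋖_.same-length (φ-⋖ p) , _⋖_.sum-plus-one (φ-⋖ p))
       (Shifted.shift-bijection H shift (toℕ v₀) refl v≤n)
  where
  -- v = v₀ + 2, so w = v - 1 = v₀ + 1 and column w + 1 = v lies in the grid.
  shift : MarkShift V ((V ─ ⁅ suc (suc v₀) ⁆) ∪ ⁅ pred (suc (suc v₀)) ⁆) (suc (toℕ v₀))
  shift = moveMark V (pred (suc (suc v₀))) (suc (suc v₀)) (toℕ-inject₁ (suc v₀)) refl v∈V v-1∉V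
  v≤n : suc (suc (toℕ v₀)) ≤ n
  v≤n = ≤-pred (toℕ<n (suc (suc v₀)))
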